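{- There is a constant $c$ such that for every nonnegative integer $m$ and every graph $G$ on $n$ vertices having at least $m+1$ independent edges, the diameter of $D_{n-m}(G)$ is at most $c\,n$; that is, the diameter of $D_{n-m}(G)$ is $O(n)$.
   Context: All graphs are finite, simple and undirected. A set $S\subseteq V(G)$ is a dominating set of $G$ if every vertex of $V(G)\setminus S$ is adjacent to a vertex of $S$. A set of edges is independent if no two share an endpoint. For a positive integer $k$, the $k$-dominating graph $D_k(G)$ has as vertices the dominating sets of $G$ of cardinality at most $k$, two such sets being adjacent iff their symmetric difference consists of exactly one vertex of $G$. The diameter of a graph is the maximum, over all pairs of its vertices, of the length of a shortest path between them. -}

module Defs where

open import Data.Nat using (ℕ; zero; suc; _≤_; _*_; _∸_)
open import Data.Fin using (Fin)
open import Data.Fin.Subset using (Subset; _∈_; _∉_; ∣_∣)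
open import Data.Product using (Σ; ∃; _×_; _,_)
open import Data.Sum using (_⊎_)
open import Relation.Nullary using (¬_)
open import Relation.Binary.PropositionalEquality using (_≡_; _≢_)
open import Function.Definitions using (Injective)

record Graph (n : ℕ) : Set₁ where
  field
    Adj     : Fin n → Fin n → Set
    sym     : ∀ {u v} → Adj u v → Adj v u
    irrefl  : ∀ {u} → ¬ Adj u u
open Graph public

Dominating : ∀ {n} → Graph n → Subset n → Set
Dominating {n} G S = ∀ (v : Fin n) → v ∉ S → ∃ λ u → u ∈ S × Adj G u v

-- Vertices of D_k(G): dominating sets of cardinality at most k.
IsDkVertex : ∀ {n} → Graph n → ℕ → Subset n → Set
IsDkVertex G k S = Dominating G S × ∣ S ∣ ≤ k

DiffByOne : ∀ {n} → Subset n → Subset n → Set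
DiffByOne {n} S T =
  Σ (Fin n) λ v →
    ((v ∈ S × v ∉ T) ⊎ (v ∉ S × v ∈ T))
    × (∀ (w : Fin n) → w ≢ v → (w ∈ S → w ∈ T) × (w ∈ T → w ∈ S))

-- A walk of length ℓ from S to T in D_k(G) (every vertex after S is
-- checked to be a vertex of D_k(G); S itself is assumed so by the user).
data DkWalk {n : ℕ} (G : Graph n) (k : ℕ) : Subset n → Subset n → ℕ → Set where
  here : ∀ {S} → DkWalk G k S S 0
  step : ∀ {S U T ℓ} → DiffByOne S U → IsDkVertex G k U →
         DkWalk G k U T ℓ → DkWalk G k S T (suc ℓ)

-- diam(D_k(G)) ≤ d : any two vertices of D_k(G) are joined by a walk
-- (hence a shortest path) of length at most d.
DiamAtMost : ∀ {n} → Graph n → ℕ → ℕ → Set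
DiamAtMost G k d = ∀ S T → IsDkVertex G k S → IsDkVertex G k T →
  ∃ λ ℓ → ℓ ≤ d × DkWalk G k S T ℓ

HasIndependentEdges : ∀ {n} → Graph n → ℕ → Set
HasIndependentEdges {n} G r =
  Σ (Fin r → Fin n) λ a → Σ (Fin r → Fin n) λ b →
    (∀ i → Adj G (a i) (b i))
    × Injective _≡_ _≡_ a × Injective _≡_ _≡_ b
    × (∀ i j → a i ≢ b j)

module Submission where

-- Let a i — b i (i ≤ m) be the independent edges and call X match-dominating
-- when every vertex outside X is matched to a vertex of X; such sets dominate.
-- Every X in D_k(G), k = n − m, walks to a match-dominating set within 2n steps,
-- inserting a vertex that violates the condition whenever |X| < k.  If |X| = k,
-- fix for every outside vertex a neighbour in X (its partner when possible) on
-- which it depends.  Were every matched vertex either outside X or depended on,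
-- counting the 2(m + 1) matched vertices would give 2(m + 1) ≤ 2|∁X| ≤ 2m; so
-- some edge has both ends in X and an end nobody depends on, and that end can be
-- deleted first.  From a match-dominating set, deleting b i while a i is present
-- and otherwise inserting a missing a i reaches the set of all vertices but the
-- b i within n steps.  Two such walks give diameter at most 6n.

open import Defs hiding (sym)
open import Data.Bool using (true)
open import Data.Fin using (Fin; zero; suc; _↑ˡ_; _↑ʳ_; join; splitAt; _≟_)
open import Data.Fin.Properties
  using (any?; all?; ¬∀⟶∃¬; splitAt-join; join-splitAt; suc-injective; 0≢1+n)
open import Data.Fin.Subset
  using (Subset; _∈_; _∉_; _⊆_; _⊂_; ∣_∣; ∁; _∪_; _─_; _-_; ⁅_⁆; inside; outside)
open import Data.Fin.Subset.Properties
  using ( _∈?_; ∣p∣≤n; x∈⁅x⁆; x∈⁅y⁆⇒x≡y; ∣⁅x⁆∣≡1; ⊆-antisym; p⊆q⇒∣p∣≤∣q∣; p⊂q⇒∣p∣<∣q∣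
        ; x∉p⇒x∈∁p; ∣∁p∣≡n∸∣p∣; p⊆p∪q; q⊆p∪q; x∈p∪q⁻; p─q⊆p; ∣p─q∣≤∣p∣
        ; x∈p∧x≢y⇒x∈p-y; x∈p⇒∣p-x∣<∣p∣ )
open import Data.Nat using (ℕ; zero; suc; _+_; _*_; _∸_; _≤_; _<_; z≤n; s≤s; _<?_)
open import Data.Nat.Induction using (<-wellFounded)
open import Data.Nat.Properties
  using ( ≤-refl; ≤-reflexive; ≤-trans; <-≤-trans; <⇒≤; <⇒≱; ≮⇒≥; n≤1+n; +-comm; +-suc
        ; +-mono-≤; +-monoʳ-≤; +-mono-<; *-suc; *-monoʳ-≤; *-distribʳ-+; ∸-monoʳ-≤
        ; m≤n+m∸n; m≤n+o⇒m∸n≤o; module ≤-Reasoning )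
open import Data.Product using (∃; _×_; _,_; proj₁; proj₂)
import Data.Product as Prod
open import Data.Sum as Sum using (_⊎_; inj₁; inj₂)
open import Data.Sum.Properties using (swap-involutive)
open import Data.Vec using (_∷_; []; _++_; tabulate; here; there)
open import Data.Vec.Properties using (lookup∘tabulate; []=⇒lookup; lookup⇒[]=)
open import Function using (_∘_; id)
open import Function.Definitions using (Injective)
open import Induction.WellFounded using (Acc; acc)
open import Level using (Level)
open import Relation.Binary.PropositionalEquality
  using (_≡_; _≢_; ≢-sym; refl; sym; trans; cong; subst; module ≡-Reasoning)
open import Relation.Nullary using (¬_; Dec; yes; no; does; map′; contradiction)
open import Relation.Nullary.Decidable
  using (_×-dec_; _⊎-dec_; ¬?; dec-true; decidable-stable)
open import Relation.Unary using (Pred; Decidable)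

private variable
  n n′ a b : ℕ
  ℓ : Level

x∈p─q⇒x∉q : ∀ {x : Fin n} (p q : Subset n) → x ∈ p ─ q → x ∉ q
x∈p─q⇒x∉q (inside ∷ p) (outside ∷ q) here ()
x∈p─q⇒x∉q (_ ∷ p) (_ ∷ q) (there x∈p─q) (there x∈q) = x∈p─q⇒x∉q p q x∈p─q x∈q

x∉p-x : ∀ (x : Fin n) (p : Subset n) → x ∉ p - x
x∉p-x x p x∈p-x = x∈p─q⇒x∉q p ⁅ x ⁆ x∈p-x (x∈⁅x⁆ x)

∣p∪q∣≤∣p∣+∣q∣ : ∀ (p q : Subset n) → ∣ p ∪ q ∣ ≤ ∣ p ∣ + ∣ q ∣
∣p∪q∣≤∣p∣+∣q∣ [] [] = z≤n
∣p∪q∣≤∣p∣+∣q∣ (inside ∷ p) (inside ∷ q) =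
  s≤s (≤-trans (∣p∪q∣≤∣p∣+∣q∣ p q) (+-monoʳ-≤ ∣ p ∣ (n≤1+n ∣ q ∣)))
∣p∪q∣≤∣p∣+∣q∣ (inside ∷ p) (outside ∷ q) = s≤s (∣p∪q∣≤∣p∣+∣q∣ p q)
∣p∪q∣≤∣p∣+∣q∣ (outside ∷ p) (inside ∷ q) =
  subst (suc ∣ p ∪ q ∣ ≤_) (sym (+-suc ∣ p ∣ ∣ q ∣)) (s≤s (∣p∪q∣≤∣p∣+∣q∣ p q))
∣p∪q∣≤∣p∣+∣q∣ (outside ∷ p) (outside ∷ q) = ∣p∪q∣≤∣p∣+∣q∣ p q

∣p∪⁅x⁆∣≤1+∣p∣ : ∀ (p : Subset n) x → ∣ p ∪ ⁅ x ⁆ ∣ ≤ suc ∣ p ∣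
∣p∪⁅x⁆∣≤1+∣p∣ p x = begin
  ∣ p ∪ ⁅ x ⁆ ∣       ≤⟨ ∣p∪q∣≤∣p∣+∣q∣ p ⁅ x ⁆ ⟩
  ∣ p ∣ + ∣ ⁅ x ⁆ ∣   ≡⟨ cong (∣ p ∣ +_) (∣⁅x⁆∣≡1 x) ⟩
  ∣ p ∣ + 1           ≡⟨ +-comm ∣ p ∣ 1 ⟩
  suc ∣ p ∣           ∎
  where open ≤-Reasoning

x∈p⇒x↑ˡ∈p++q : ∀ {x : Fin n} {p : Subset n} (q : Subset n′) → x ∈ p → x ↑ˡ n′ ∈ p ++ q
x∈p⇒x↑ˡ∈p++q q here = here
x∈p⇒x↑ˡ∈p++q q (there x∈p) = there (x∈p⇒x↑ˡ∈p++q q x∈p)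

x∈q⇒x↑ʳ∈p++q : ∀ {x : Fin n′} {q : Subset n′} (p : Subset n) → x ∈ q → n ↑ʳ x ∈ p ++ q
x∈q⇒x↑ʳ∈p++q [] x∈q = x∈q
x∈q⇒x↑ʳ∈p++q (_ ∷ p) x∈q = there (x∈q⇒x↑ʳ∈p++q p x∈q)

∣p++q∣≡∣p∣+∣q∣ : ∀ (p : Subset n) (q : Subset n′) → ∣ p ++ q ∣ ≡ ∣ p ∣ + ∣ q ∣
∣p++q∣≡∣p∣+∣q∣ [] q = refl
∣p++q∣≡∣p∣+∣q∣ (inside ∷ p) q = cong suc (∣p++q∣≡∣p∣+∣q∣ p q)
∣p++q∣≡∣p∣+∣q∣ (outside ∷ p) q = ∣p++q∣≡∣p∣+∣q∣ p q

injective⇒≤∣p∣ : ∀ (p : Subset n) (f : Fin a → Fin n) →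
  Injective _≡_ _≡_ f → (∀ i → f i ∈ p) → a ≤ ∣ p ∣
injective⇒≤∣p∣ {a = zero} p f f-inj f∈p = z≤n
injective⇒≤∣p∣ {a = suc a} p f f-inj f∈p = begin-strict
  a               ≤⟨ injective⇒≤∣p∣ (p - f zero) (f ∘ suc) (suc-injective ∘ f-inj) f∘suc∈p-f0 ⟩
  ∣ p - f zero ∣  <⟨ x∈p⇒∣p-x∣<∣p∣ (f∈p zero) ⟩
  ∣ p ∣           ∎
  where
  open ≤-Reasoning
  f∘suc∈p-f0 : ∀ i → f (suc i) ∈ p - f zero
  f∘suc∈p-f0 i = x∈p∧x≢y⇒x∈p-y (f∈p (suc i)) (0≢1+n ∘ sym ∘ f-inj)

injective⇒≤∣p∣+∣q∣ : ∀ (p : Subset n) (q : Subset n′) (f : Fin a ⊎ Fin b → Fin n ⊎ Fin n′) →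
  Injective _≡_ _≡_ f → (∀ t → Sum.[ _∈ p , _∈ q ]′ (f t)) → a + b ≤ ∣ p ∣ + ∣ q ∣
injective⇒≤∣p∣+∣q∣ {n} {n′} {a} {b} p q f f-inj f∈ =
  subst (a + b ≤_) (∣p++q∣≡∣p∣+∣q∣ p q)
    (injective⇒≤∣p∣ (p ++ q) (join n n′ ∘ f ∘ splitAt a) (splitAt-injective ∘ f-inj ∘ join-injective)
      (λ i → join-∈ (f (splitAt a i)) (f∈ (splitAt a i))))
  where
  splitAt-injective : Injective _≡_ _≡_ (splitAt a {b})
  splitAt-injective {i} {j} eq =
    trans (sym (join-splitAt a b i)) (trans (cong (join a b) eq) (join-splitAt a b j))
  join-injective : Injective _≡_ _≡_ (join n n′)
  join-injective {z} {z′} eq =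
    trans (sym (splitAt-join n n′ z)) (trans (cong (splitAt n) eq) (splitAt-join n n′ z′))
  join-∈ : ∀ z → Sum.[ _∈ p , _∈ q ]′ z → join n n′ z ∈ p ++ q
  join-∈ (inj₁ x) x∈p = x∈p⇒x↑ˡ∈p++q q x∈p
  join-∈ (inj₂ x) x∈q = x∈q⇒x↑ʳ∈p++q p x∈q

⟦_⟧ : ∀ {P : Pred (Fin n) ℓ} → Decidable P → Subset n
⟦ P? ⟧ = tabulate (does ∘ P?)

∈⟦⟧⁺ : ∀ {P : Pred (Fin n) ℓ} (P? : Decidable P) {x} → P x → x ∈ ⟦ P? ⟧
∈⟦⟧⁺ P? {x} px =
  lookup⇒[]= x ⟦ P? ⟧ (trans (lookup∘tabulate (does ∘ P?) x) (dec-true (P? x) px))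

∈⟦⟧⁻ : ∀ {ℓ} {P : Pred (Fin n) ℓ} (P? : Decidable P) {x} → x ∈ ⟦ P? ⟧ → P x
∈⟦⟧⁻ {ℓ = ℓ} P? {x} x∈ =
  reflect (P? x) (trans (sym (lookup∘tabulate (does ∘ P?) x)) ([]=⇒lookup x∈))
  where
  reflect : ∀ {A : Set ℓ} (a? : Dec A) → does a? ≡ true → A
  reflect (yes a) _ = a
  reflect (no _) ()

⟦⟧-⊆ : ∀ {P Q : Pred (Fin n) ℓ} (Q? : Decidable Q) (P? : Decidable P) →
       (∀ {x} → Q x → P x) → ⟦ Q? ⟧ ⊆ ⟦ P? ⟧
⟦⟧-⊆ Q? P? Q⇒P = ∈⟦⟧⁺ P? ∘ Q⇒P ∘ ∈⟦⟧⁻ Q?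

⟦⟧-⊂ : ∀ {P Q : Pred (Fin n) ℓ} (Q? : Decidable Q) (P? : Decidable P) → (∀ {x} → Q x → P x) →
       ∀ {w} → P w → ¬ Q w → ⟦ Q? ⟧ ⊂ ⟦ P? ⟧
⟦⟧-⊂ Q? P? Q⇒P {w} pw ¬qw = ⟦⟧-⊆ Q? P? Q⇒P , w , ∈⟦⟧⁺ P? pw , ¬qw ∘ ∈⟦⟧⁻ Q?

any⊎? : ∀ {P : Pred (Fin a ⊎ Fin b) ℓ} → Decidable P → Dec (∃ P)
any⊎? {P = P} P? = map′ join∃ split∃ (any? (P? ∘ inj₁) ⊎-dec any? (P? ∘ inj₂))
  where
  join∃ : ∃ (P ∘ inj₁) ⊎ ∃ (P ∘ inj₂) → ∃ P
  join∃ (inj₁ (i , p)) = inj₁ i , p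
  join∃ (inj₂ (i , p)) = inj₂ i , p
  split∃ : ∃ P → ∃ (P ∘ inj₁) ⊎ ∃ (P ∘ inj₂)
  split∃ (inj₁ i , p) = inj₁ (i , p)
  split∃ (inj₂ i , p) = inj₂ (i , p)

module _ (G : Graph n) where

  dominating-⊆ : ∀ {X Y} → X ⊆ Y → Dominating G X → Dominating G Y
  dominating-⊆ X⊆Y dom v v∉Y with dom v (v∉Y ∘ X⊆Y)
  ... | u , u∈X , u~v = u , X⊆Y u∈X , u~v

  dominating-remove : ∀ {X} (g : Fin n → Fin n) → (∀ v → v ∉ X → g v ∈ X × Adj G (g v) v) →
    ∀ {x u} → u ∈ X → u ≢ x → Adj G u x → (∀ v → v ∉ X → g v ≢ x) → Dominating G (X - x)
  dominating-remove {X} g g-dom {x} {u} u∈X u≢x u~x g≢x v v∉X-x with v ≟ x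
  ... | yes refl = u , x∈p∧x≢y⇒x∈p-y u∈X u≢x , u~x
  ... | no v≢x   = g v , x∈p∧x≢y⇒x∈p-y gv∈X (g≢x v v∉X) , gv~v
    where
    v∉X : v ∉ X
    v∉X v∈X = v∉X-x (x∈p∧x≢y⇒x∈p-y v∈X v≢x)
    gv∈X : g v ∈ X
    gv∈X = proj₁ (g-dom v v∉X)
    gv~v : Adj G (g v) v
    gv~v = proj₂ (g-dom v v∉X)

-- A vertex outside p is reached at most twice: as some e t ∉ p, and as a
-- g-dependent of some e t ∈ p, from which g recovers e t.
dependents⇒≤∣∁p∣+∣∁p∣ : ∀ (p : Subset n) (g : Fin n → Fin n) (e : Fin a ⊎ Fin b → Fin n) →
  Injective _≡_ _≡_ e → (∀ t → e t ∈ p → ∃ λ v → v ∉ p × g v ≡ e t) →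
  a + b ≤ ∣ ∁ p ∣ + ∣ ∁ p ∣
dependents⇒≤∣∁p∣+∣∁p∣ {n} {a} {b} p g e e-inj dependent =
  injective⇒≤∣p∣+∣q∣ (∁ p) (∁ p) τ τ-injective (λ t → token-∈ t (e t ∈? p))
  where
  token : ∀ t → Dec (e t ∈ p) → Fin n ⊎ Fin n
  token t (yes e∈p) = inj₂ (proj₁ (dependent t e∈p))
  token t (no _)    = inj₁ (e t)

  τ : Fin a ⊎ Fin b → Fin n ⊎ Fin n
  τ t = token t (e t ∈? p)

  recover : Fin n ⊎ Fin n → Fin n
  recover = Sum.[ id , g ]′

  recover-token : ∀ t d → recover (token t d) ≡ e t
  recover-token t (yes e∈p) = proj₂ (proj₂ (dependent t e∈p))
  recover-token t (no _)    = refl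

  τ-injective : Injective _≡_ _≡_ τ
  τ-injective {s} {t} eq = e-inj (begin
    e s                ≡⟨ recover-token s (e s ∈? p) ⟨
    recover (τ s)      ≡⟨ cong recover eq ⟩
    recover (τ t)      ≡⟨ recover-token t (e t ∈? p) ⟩
    e t                ∎)
    where open ≡-Reasoning

  token-∈ : ∀ t d → Sum.[ _∈ ∁ p , _∈ ∁ p ]′ (token t d)
  token-∈ t (yes e∈p) = x∉p⇒x∈∁p (proj₁ (proj₂ (dependent t e∈p)))
  token-∈ t (no e∉p)  = x∉p⇒x∈∁p e∉p

diffByOne-insert : ∀ {X : Subset n} {x} → x ∉ X → DiffByOne X (X ∪ ⁅ x ⁆)
diffByOne-insert {X = X} {x} x∉X =
  x , inj₂ (x∉X , q⊆p∪q X ⁅ x ⁆ (x∈⁅x⁆ x)) , λ w w≢x → p⊆p∪q ⁅ x ⁆ , back w≢x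
  where
  back : ∀ {w} → w ≢ x → w ∈ X ∪ ⁅ x ⁆ → w ∈ X
  back w≢x w∈ =
    Sum.[ id , (λ w∈⁅x⁆ → contradiction (x∈⁅y⁆⇒x≡y x w∈⁅x⁆) w≢x) ]′ (x∈p∪q⁻ X ⁅ x ⁆ w∈)

diffByOne-remove : ∀ {X : Subset n} {x} → x ∈ X → DiffByOne X (X - x)
diffByOne-remove {X = X} {x} x∈X =
  x , inj₁ (x∈X , x∉p-x x X) , λ w w≢x → (λ w∈X → x∈p∧x≢y⇒x∈p-y w∈X w≢x) , p─q⊆p X ⁅ x ⁆

diffByOne-sym : ∀ {X Y : Subset n} → DiffByOne X Y → DiffByOne Y X
diffByOne-sym (v , v∈Δ , same) =
  v , Sum.swap (Sum.map Prod.swap Prod.swap v∈Δ) , λ w w≢v → Prod.swap (same w w≢v)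

module _ (G : Graph n) (k : ℕ) where

  Reach : Subset n → Subset n → ℕ → Set
  Reach X Y d = ∃ λ ℓ → ℓ ≤ d × DkWalk G k X Y ℓ

  walk-++ : ∀ {X Y Z ℓ ℓ′} → DkWalk G k X Y ℓ → DkWalk G k Y Z ℓ′ → DkWalk G k X Z (ℓ + ℓ′)
  walk-++ here w = w
  walk-++ (step d Y∈D w) w′ = step d Y∈D (walk-++ w w′)

  walk-reverse : ∀ {X Y ℓ} → IsDkVertex G k X → DkWalk G k X Y ℓ → DkWalk G k Y X ℓ
  walk-reverse X∈D here = here
  walk-reverse {ℓ = suc ℓ} X∈D (step d U∈D w) =
    subst (DkWalk G k _ _) (+-comm ℓ 1)
      (walk-++ (walk-reverse U∈D w) (step (diffByOne-sym d) X∈D here))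

  reach-step : ∀ {X Y} → DiffByOne X Y → IsDkVertex G k Y → Reach X Y 1
  reach-step d Y∈D = 1 , ≤-refl , step d Y∈D here

  reach-trans : ∀ {X Y Z d d′} → Reach X Y d → Reach Y Z d′ → Reach X Z (d + d′)
  reach-trans (ℓ , ℓ≤d , w) (ℓ′ , ℓ′≤d′ , w′) = ℓ + ℓ′ , +-mono-≤ ℓ≤d ℓ′≤d′ , walk-++ w w′

  reach-sym : ∀ {X Y d} → IsDkVertex G k X → Reach X Y d → Reach Y X d
  reach-sym X∈D (ℓ , ℓ≤d , w) = ℓ , ℓ≤d , walk-reverse X∈D w

  reach-mono : ∀ {X Y d d′} → d ≤ d′ → Reach X Y d → Reach X Y d′
  reach-mono d≤d′ (ℓ , ℓ≤d , w) = ℓ , ≤-trans ℓ≤d d≤d′ , w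

  descend : ∀ {Inv Done : Subset n → Set} (μ : Subset n → ℕ) (s : ℕ) →
    (∀ X → Inv X → Done X ⊎ ∃ λ Y → Inv Y × μ Y < μ X × Reach X Y s) →
    ∀ X → Inv X → ∃ λ Y → Done Y × Inv Y × Reach X Y (s * μ X)
  descend {Inv} {Done} μ s progress X inv = go X (<-wellFounded (μ X)) inv
    where
    go : ∀ X → Acc _<_ (μ X) → Inv X → ∃ λ Y → Done Y × Inv Y × Reach X Y (s * μ X)
    go X (acc rec) inv with progress X inv
    ... | inj₁ done = X , done , inv , 0 , z≤n , here
    ... | inj₂ (Y , invY , μY<μX , X⇝Y) with go Y (rec μY<μX) invY
    ...   | Z , done , invZ , Y⇝Z = Z , done , invZ , reach-mono bound (reach-trans X⇝Y Y⇝Z)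
      where
      bound : s + s * μ Y ≤ s * μ X
      bound = ≤-trans (≤-reflexive (sym (*-suc s (μ Y)))) (*-monoʳ-≤ s μY<μX)

-- end (inj₁ i) and end (inj₂ i) are the endpoints of the i-th edge; Sum.swap
-- passes from an endpoint to its partner.
record Matching (G : Graph n) (r : ℕ) : Set where
  field
    end           : Fin r ⊎ Fin r → Fin n
    end-injective : Injective _≡_ _≡_ end
    end-adjacent  : ∀ t → Adj G (end t) (end (Sum.swap t))

independentEdges⇒matching : ∀ {G : Graph n} {r} → HasIndependentEdges G r → Matching G r
independentEdges⇒matching {G = G} (a , b , a~b , a-inj , b-inj , a≢b) = record
  { end           = Sum.[ a , b ]′
  ; end-injective = injective
  ; end-adjacent  = Sum.[ a~b , Graph.sym G ∘ a~b ]
  }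
  where
  injective : Injective _≡_ _≡_ Sum.[ a , b ]′
  injective {inj₁ i} {inj₁ j} eq = cong inj₁ (a-inj eq)
  injective {inj₁ i} {inj₂ j} eq = contradiction eq (a≢b i j)
  injective {inj₂ i} {inj₁ j} eq = contradiction (sym eq) (a≢b j i)
  injective {inj₂ i} {inj₂ j} eq = cong inj₂ (b-inj eq)

module Reconfiguration {G : Graph n} {m : ℕ} (matching : Matching G (suc m)) where

  open Matching matching

  k : ℕ
  k = n ∸ m

  end≢end-swap : ∀ t → end t ≢ end (Sum.swap t)
  end≢end-swap t eq = Graph.irrefl G (subst (Adj G (end t)) (sym eq) (end-adjacent t))

  _matchedInto_ : Fin n → Subset n → Set
  v matchedInto X = ∃ λ t → end t ≡ v × end (Sum.swap t) ∈ X

  matchedInto? : ∀ X → Decidable (_matchedInto X)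
  matchedInto? X v = any⊎? (λ t → end t ≟ v ×-dec end (Sum.swap t) ∈? X)

  Settled : Subset n → Fin n → Set
  Settled X v = v ∈ X ⊎ v matchedInto X

  settled? : ∀ X → Decidable (Settled X)
  settled? X v = v ∈? X ⊎-dec matchedInto? X v

  MatchDominating : Subset n → Set
  MatchDominating X = ∀ v → Settled X v

  matchDominating⇒dominating : ∀ {X} → MatchDominating X → Dominating G X
  matchDominating⇒dominating md v v∉X with md v
  ... | inj₁ v∈X = contradiction v∈X v∉X
  ... | inj₂ (t , refl , partner∈X) = end (Sum.swap t) , partner∈X , Graph.sym G (end-adjacent t)

  settled-mono : ∀ {X Y v} → X ⊆ Y → Settled X v → Settled Y v
  settled-mono X⊆Y = Sum.map X⊆Y (Prod.map₂ (Prod.map₂ X⊆Y))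

  settled-remove : ∀ {X t v} → end (Sum.swap t) ∈ X → Settled X v → Settled (X - end t) v
  settled-remove {X} {t} {v} partner∈X (inj₁ v∈X) with v ≟ end t
  ... | yes refl = inj₂ (t , refl , x∈p∧x≢y⇒x∈p-y partner∈X (≢-sym (end≢end-swap t)))
  ... | no v≢x   = inj₁ (x∈p∧x≢y⇒x∈p-y v∈X v≢x)
  settled-remove {X} {t} partner∈X (inj₂ (s , refl , partner-s∈X)) with end (Sum.swap s) ≟ end t
  ... | no ≢x  = inj₂ (s , refl , x∈p∧x≢y⇒x∈p-y partner-s∈X ≢x)
  ... | yes eq = inj₁ (x∈p∧x≢y⇒x∈p-y (subst (_∈ X) (sym es≡) partner∈X)
                                     (≢-sym (subst (end t ≢_) (sym es≡) (end≢end-swap t))))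
    where
    es≡ : end s ≡ end (Sum.swap t)
    es≡ = cong end (trans (sym (swap-involutive s)) (cong Sum.swap (end-injective eq)))

  module _ {X : Subset n} (dom : Dominating G X) where

    -- A neighbour in X of each vertex outside X, preferring its matching partner
    -- (junk value v for v ∈ X).
    dominator : Fin n → Fin n
    dominator v with v ∈? X | matchedInto? X v
    ... | yes _   | _            = v
    ... | no _    | yes (t , _)  = end (Sum.swap t)
    ... | no v∉X  | no _         = proj₁ (dom v v∉X)

    dominator-dominates : ∀ v → v ∉ X → dominator v ∈ X × Adj G (dominator v) v
    dominator-dominates v v∉X with v ∈? X | matchedInto? X v
    ... | yes v∈X | _                         = contradiction v∈X v∉X
    ... | no _    | yes (t , refl , partner∈X) = partner∈X , Graph.sym G (end-adjacent t)
    ... | no v∉X′ | no _                      = proj₂ (dom v v∉X′)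

    dominator-partner : ∀ t → end (Sum.swap t) ∉ X → end t ∈ X →
                        dominator (end (Sum.swap t)) ≡ end t
    dominator-partner t partner∉X e∈X
      with end (Sum.swap t) ∈? X | matchedInto? X (end (Sum.swap t))
    ... | yes partner∈X | _ = contradiction partner∈X partner∉X
    ... | no _ | yes (s , eq , _) =
      cong end (trans (cong Sum.swap (end-injective eq)) (swap-involutive t))
    ... | no _ | no unmatched = contradiction (Sum.swap t , refl , e∈X′) unmatched
      where
      e∈X′ : end (Sum.swap (Sum.swap t)) ∈ X
      e∈X′ = subst (_∈ X) (cong end (sym (swap-involutive t))) e∈X

    HasDependent : Fin n → Set
    HasDependent x = ∃ λ v → v ∉ X × dominator v ≡ x

    hasDependent? : Decidable HasDependent
    hasDependent? x = any? (λ v → ¬? (v ∈? X) ×-dec dominator v ≟ x)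

    crowded⇒removable : ¬ ∣ X ∣ < k →
      ∃ λ t → end t ∈ X × end (Sum.swap t) ∈ X × ¬ HasDependent (end t)
    crowded⇒removable full
      with any⊎? (λ t → end t ∈? X ×-dec end (Sum.swap t) ∈? X ×-dec ¬? (hasDependent? (end t)))
    ... | yes removable = removable
    ... | no none = contradiction (dependents⇒≤∣∁p∣+∣∁p∣ X dominator end end-injective dependent)
                                  (<⇒≱ (+-mono-< ∣∁X∣<M ∣∁X∣<M))
      where
      dependent : ∀ t → end t ∈ X → HasDependent (end t)
      dependent t e∈X with end (Sum.swap t) ∈? X
      ... | no partner∉X = end (Sum.swap t) , partner∉X , dominator-partner t partner∉X e∈X
      ... | yes partner∈X =
        decidable-stable (hasDependent? (end t)) (λ ¬dep → none (t , e∈X , partner∈X , ¬dep))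

      ∣∁X∣<M : ∣ ∁ X ∣ < suc m
      ∣∁X∣<M = s≤s (begin
        ∣ ∁ X ∣        ≡⟨ ∣∁p∣≡n∸∣p∣ X ⟩
        n ∸ ∣ X ∣      ≤⟨ ∸-monoʳ-≤ n (≮⇒≥ full) ⟩
        n ∸ (n ∸ m)    ≤⟨ m≤n+o⇒m∸n≤o n (n ∸ m) (subst (n ≤_) (+-comm m _) (m≤n+m∸n n m)) ⟩
        m              ∎)
        where open ≤-Reasoning

    sparse⇒room : (∀ t → end t ∈ X → end (Sum.swap t) ∉ X) → ∣ X ∣ < k
    sparse⇒room sparse with ∣ X ∣ <? k
    ... | yes room = room
    ... | no full with crowded⇒removable full
    ...   | t , e∈X , partner∈X , _ = contradiction partner∈X (sparse t e∈X)

  unsettled : Subset n → Subset n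
  unsettled X = ⟦ ¬? ∘ settled? X ⟧

  insert-unsettled : ∀ {X w} → IsDkVertex G k X → ∣ X ∣ < k → ¬ Settled X w →
    IsDkVertex G k (X ∪ ⁅ w ⁆) × ∣ unsettled (X ∪ ⁅ w ⁆) ∣ < ∣ unsettled X ∣ ×
    Reach G k X (X ∪ ⁅ w ⁆) 1
  insert-unsettled {X} {w} (dom , _) room w-unsettled =
    X′∈D , fewer , reach-step G k (diffByOne-insert (w-unsettled ∘ inj₁)) X′∈D
    where
    X⊆X′ : X ⊆ X ∪ ⁅ w ⁆
    X⊆X′ = p⊆p∪q ⁅ w ⁆
    X′∈D : IsDkVertex G k (X ∪ ⁅ w ⁆)
    X′∈D = dominating-⊆ G X⊆X′ dom , ≤-trans (∣p∪⁅x⁆∣≤1+∣p∣ X w) room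
    w-settled : Settled (X ∪ ⁅ w ⁆) w
    w-settled = inj₁ (q⊆p∪q X ⁅ w ⁆ (x∈⁅x⁆ w))
    fewer : ∣ unsettled (X ∪ ⁅ w ⁆) ∣ < ∣ unsettled X ∣
    fewer = p⊂q⇒∣p∣<∣q∣ (⟦⟧-⊂ (¬? ∘ settled? (X ∪ ⁅ w ⁆)) (¬? ∘ settled? X)
                          (λ ¬s → ¬s ∘ settled-mono X⊆X′) w-unsettled (λ ¬s → ¬s w-settled))

  make-room : ∀ {X} → IsDkVertex G k X → ¬ ∣ X ∣ < k →
    ∃ λ X′ → X′ ⊆ X × IsDkVertex G k X′ × ∣ X′ ∣ < k × unsettled X′ ⊆ unsettled X ×
             Reach G k X X′ 1
  make-room {X} (dom , size) full with crowded⇒removable dom full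
  ... | t , e∈X , partner∈X , independent =
    X - end t , p─q⊆p X ⁅ end t ⁆ , X′∈D , room , fewer , reach-step G k (diffByOne-remove e∈X) X′∈D
    where
    room : ∣ X - end t ∣ < k
    room = <-≤-trans (x∈p⇒∣p-x∣<∣p∣ e∈X) size
    X′∈D : IsDkVertex G k (X - end t)
    X′∈D = dominating-remove G (dominator dom) (dominator-dominates dom) partner∈X
             (≢-sym (end≢end-swap t)) (Graph.sym G (end-adjacent t))
             (λ v v∉X eq → independent (v , v∉X , eq))
         , <⇒≤ room
    fewer : unsettled (X - end t) ⊆ unsettled X
    fewer = ⟦⟧-⊆ (¬? ∘ settled? (X - end t)) (¬? ∘ settled? X) (λ ¬s → ¬s ∘ settled-remove partner∈X)

  settle-step : ∀ X → IsDkVertex G k X →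
    MatchDominating X ⊎
    ∃ λ Y → IsDkVertex G k Y × ∣ unsettled Y ∣ < ∣ unsettled X ∣ × Reach G k X Y 2
  settle-step X X∈D with all? (settled? X)
  ... | yes md  = inj₁ md
  ... | no ¬md = inj₂ (settle (¬∀⟶∃¬ n (Settled X) (settled? X) ¬md) (∣ X ∣ <? k))
    where
    settle : ∃ (¬_ ∘ Settled X) → Dec (∣ X ∣ < k) →
      ∃ λ Y → IsDkVertex G k Y × ∣ unsettled Y ∣ < ∣ unsettled X ∣ × Reach G k X Y 2
    settle (w , w-unsettled) (yes room) =
      let Y∈D , fewer , X⇝Y = insert-unsettled X∈D room w-unsettled
      in X ∪ ⁅ w ⁆ , Y∈D , fewer , reach-mono G k (s≤s z≤n) X⇝Y
    settle (w , w-unsettled) (no full) =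
      let X′ , X′⊆X , X′∈D , room , fewer′ , X⇝X′ = make-room X∈D full
          Y∈D , fewer , X′⇝Y = insert-unsettled X′∈D room (w-unsettled ∘ settled-mono X′⊆X)
      in X′ ∪ ⁅ w ⁆ , Y∈D , <-≤-trans fewer (p⊆q⇒∣p∣≤∣q∣ fewer′) , reach-trans G k X⇝X′ X′⇝Y

  reach-matchDominating : ∀ X → IsDkVertex G k X →
    ∃ λ Y → MatchDominating Y × IsDkVertex G k Y × Reach G k X Y (2 * n)
  reach-matchDominating X X∈D =
    let Y , md , Y∈D , X⇝Y = descend G k (∣_∣ ∘ unsettled) 2 settle-step X X∈D
    in Y , md , Y∈D , reach-mono G k (*-monoʳ-≤ 2 (∣p∣≤n (unsettled X))) X⇝Y

  left right : Fin (suc m) → Fin n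
  left i  = end (inj₁ i)
  right i = end (inj₂ i)

  IsRight : Fin n → Set
  IsRight v = ∃ λ i → right i ≡ v

  isRight? : Decidable IsRight
  isRight? v = any? (λ i → right i ≟ v)

  nonRight : Subset n
  nonRight = ⟦ ¬? ∘ isRight? ⟧

  Misplaced : Subset n → Fin n → Set
  Misplaced X v = v ∈ X × IsRight v ⊎ v ∉ X × ¬ IsRight v

  misplaced? : ∀ X → Decidable (Misplaced X)
  misplaced? X v = (v ∈? X ×-dec isRight? v) ⊎-dec (¬? (v ∈? X) ×-dec ¬? (isRight? v))

  misplaced : Subset n → Subset n
  misplaced X = ⟦ misplaced? X ⟧

  misplaced-remove : ∀ {X x} → x ∈ X → IsRight x → ∣ misplaced (X - x) ∣ < ∣ misplaced X ∣
  misplaced-remove {X} {x} x∈X x-right =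
    p⊂q⇒∣p∣<∣q∣ (⟦⟧-⊂ (misplaced? (X - x)) (misplaced? X) shrink (inj₁ (x∈X , x-right)) fixed)
    where
    shrink : ∀ {v} → Misplaced (X - x) v → Misplaced X v
    shrink (inj₁ (v∈X′ , v-right)) = inj₁ (p─q⊆p X ⁅ x ⁆ v∈X′ , v-right)
    shrink {v} (inj₂ (v∉X′ , v-nonRight)) =
      inj₂ ((λ v∈X → v∉X′ (x∈p∧x≢y⇒x∈p-y v∈X (λ { refl → v-nonRight x-right }))) , v-nonRight)
    fixed : ¬ Misplaced (X - x) x
    fixed (inj₁ (x∈X′ , _)) = x∉p-x x X x∈X′
    fixed (inj₂ (_ , x-nonRight)) = x-nonRight x-right

  misplaced-insert : ∀ {X x} → x ∉ X → ¬ IsRight x → ∣ misplaced (X ∪ ⁅ x ⁆) ∣ < ∣ misplaced X ∣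
  misplaced-insert {X} {x} x∉X x-nonRight =
    p⊂q⇒∣p∣<∣q∣ (⟦⟧-⊂ (misplaced? (X ∪ ⁅ x ⁆)) (misplaced? X) shrink (inj₂ (x∉X , x-nonRight)) fixed)
    where
    shrink : ∀ {v} → Misplaced (X ∪ ⁅ x ⁆) v → Misplaced X v
    shrink (inj₁ (v∈X′ , v-right)) with x∈p∪q⁻ X ⁅ x ⁆ v∈X′
    ... | inj₁ v∈X  = inj₁ (v∈X , v-right)
    ... | inj₂ v∈⁅x⁆ with x∈⁅y⁆⇒x≡y x v∈⁅x⁆
    ...   | refl = contradiction v-right x-nonRight
    shrink (inj₂ (v∉X′ , v-nonRight)) = inj₂ (v∉X′ ∘ p⊆p∪q ⁅ x ⁆ , v-nonRight)
    fixed : ¬ Misplaced (X ∪ ⁅ x ⁆) x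
    fixed (inj₁ (_ , x-right)) = x-nonRight x-right
    fixed (inj₂ (x∉X′ , _)) = x∉X′ (q⊆p∪q X ⁅ x ⁆ (x∈⁅x⁆ x))

  StepToNonRight : Subset n → Set
  StepToNonRight X =
    ∃ λ Y → (MatchDominating Y × ∣ Y ∣ ≤ k) × ∣ misplaced Y ∣ < ∣ misplaced X ∣ × Reach G k X Y 1

  remove-right : ∀ {X} i → MatchDominating X → ∣ X ∣ ≤ k → left i ∈ X → right i ∈ X →
                 StepToNonRight X
  remove-right {X} i md size l∈X r∈X =
    X - right i , inv , misplaced-remove r∈X (i , refl) ,
    reach-step G k (diffByOne-remove r∈X) (matchDominating⇒dominating (proj₁ inv) , proj₂ inv)
    where
    inv : MatchDominating (X - right i) × ∣ X - right i ∣ ≤ k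
    inv = (λ v → settled-remove {t = inj₂ i} l∈X (md v)) , ≤-trans (∣p─q∣≤∣p∣ X ⁅ right i ⁆) size

  insert-left : ∀ {X} i → MatchDominating X → (∀ j → ¬ (left j ∈ X × right j ∈ X)) → left i ∉ X →
                StepToNonRight X
  insert-left {X} i md ¬both l∉X =
    X ∪ ⁅ left i ⁆ , inv , misplaced-insert l∉X left-nonRight ,
    reach-step G k (diffByOne-insert l∉X) (matchDominating⇒dominating (proj₁ inv) , proj₂ inv)
    where
    sparse : ∀ t → end t ∈ X → end (Sum.swap t) ∉ X
    sparse (inj₁ j) l∈X r∈X = ¬both j (l∈X , r∈X)
    sparse (inj₂ j) r∈X l∈X = ¬both j (l∈X , r∈X)
    left-nonRight : ¬ IsRight (left i)
    left-nonRight (j , eq) with end-injective eq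
    ... | ()
    inv : MatchDominating (X ∪ ⁅ left i ⁆) × ∣ X ∪ ⁅ left i ⁆ ∣ ≤ k
    inv = (λ v → settled-mono (p⊆p∪q ⁅ left i ⁆) (md v))
        , ≤-trans (∣p∪⁅x⁆∣≤1+∣p∣ X (left i)) (sparse⇒room (matchDominating⇒dominating md) sparse)

  lefts-only⇒nonRight : ∀ {X} → MatchDominating X → (∀ j → ¬ (left j ∈ X × right j ∈ X)) →
    (∀ i → left i ∈ X) → X ≡ nonRight
  lefts-only⇒nonRight {X} md ¬both left∈X = ⊆-antisym X⊆nonRight nonRight⊆X
    where
    X⊆nonRight : X ⊆ nonRight
    X⊆nonRight v∈X = ∈⟦⟧⁺ (¬? ∘ isRight?) (λ { (i , refl) → ¬both i (left∈X i , v∈X) })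
    nonRight⊆X : nonRight ⊆ X
    nonRight⊆X {v} v∈nonRight with md v
    ... | inj₁ v∈X = v∈X
    ... | inj₂ (inj₁ i , refl , _) = left∈X i
    ... | inj₂ (inj₂ i , refl , _) = contradiction (i , refl) (∈⟦⟧⁻ (¬? ∘ isRight?) v∈nonRight)

  towards-nonRight : ∀ X → MatchDominating X × ∣ X ∣ ≤ k → X ≡ nonRight ⊎ StepToNonRight X
  towards-nonRight X (md , size) with any? (λ i → left i ∈? X ×-dec right i ∈? X)
  ... | yes (i , l∈X , r∈X) = inj₂ (remove-right i md size l∈X r∈X)
  ... | no both with any? (λ i → ¬? (left i ∈? X))
  ...   | yes (i , l∉X) = inj₂ (insert-left i md (λ j p → both (j , p)) l∉X)
  ...   | no missing = inj₁ (lefts-only⇒nonRight md (λ j p → both (j , p))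
                               (λ i → decidable-stable (left i ∈? X) (λ l∉X → missing (i , l∉X))))

  reach-nonRight : ∀ X → MatchDominating X → ∣ X ∣ ≤ k → Reach G k X nonRight (1 * n)
  reach-nonRight X md size =
    let Y , Y≡nonRight , _ , X⇝Y = descend G k (∣_∣ ∘ misplaced) 1 towards-nonRight X (md , size)
    in subst (λ Z → Reach G k X Z (1 * n)) Y≡nonRight
             (reach-mono G k (*-monoʳ-≤ 1 (∣p∣≤n (misplaced X))) X⇝Y)

  diameter : DiamAtMost G k (6 * n)
  diameter S T S∈D T∈D = reach-mono G k (≤-reflexive (sym (*-distribʳ-+ n 3 3)))
                           (reach-trans G k (to-nonRight S S∈D) (reach-sym G k T∈D (to-nonRight T T∈D)))
    where
    to-nonRight : ∀ X → IsDkVertex G k X → Reach G k X nonRight (3 * n)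
    to-nonRight X X∈D =
      let Y , md , (_ , size) , X⇝Y = reach-matchDominating X X∈D
      in reach-mono G k (≤-reflexive (sym (*-distribʳ-+ n 2 1)))
                        (reach-trans G k X⇝Y (reach-nonRight Y md size))

corollary1 : ∃ λ (c : ℕ) → ∀ (m n : ℕ) (G : Graph n) →
    HasIndependentEdges G (suc m) → DiamAtMost G (n ∸ m) (c * n)
corollary1 = 6 , λ m n G edges → Reconfiguration.diameter (independentEdges⇒matching edges)
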